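{- Let $c>b>a\ge 2$ be pairwise coprime integers, let $k=\lfloor c/b\rfloor$, let $\ell\in\{0,1,\ldots,a-1\}$ with $\ell\equiv cb^{ -1}\pmod a$, let $q=\lfloor a/(a-\ell)\rfloor$, $r=a-q(a-\ell)$, and $u=(a-\ell)\bmod r$. Suppose $\ell>k$ and $br>cq$. Let $A=br-cq$, $B=b(a-\ell-r)+c(q+1)$, and $$\mu=\min\left\{i\in\mathbb{Z}_{\ge0}\,\Big|\,\left\lfloor\tfrac{(i+1)B}{A}\right\rfloor\ne\left\lfloor\tfrac{(i+1)(a-\ell-r)}{r}\right\rfloor\right\},$$ and assume $\mu>\lfloor r/u\rfloor$. Let $\mathscr{X}=\{x\in\{1,\ldots,r\}\mid\mathbf{m}(bx)\equiv0\pmod c\}$ and, for $0\le i\le\mu$, $x_i=r\left(\lfloor\tfrac{ui}{r}\rfloor+1\right)-ui$. Then $\mathscr{X}=\{x_i\mid 0\le i\le\mu\}$, $x_\mu$ is the smallest element of $\mathscr{X}$ that is larger than $u$, and, when the elements of $\mathscr{X}$ are listed in increasing order, the difference between any two consecutive elements is either $\widehat{x}:=\min\mathscr{X}$ or $\widehat{x}+u-x_\mu$.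
   Context: Reductions modulo $n$ are taken in $\{0,1,\ldots,n-1\}$. For an integer $z$, $\mathbf{m}(z)$ denotes the least positive integer of the form $bn_1+cn_2$ with $n_1,n_2$ non-negative integers that is congruent to $z$ modulo $a$. -}

module Defs where

open import Data.Nat using (ℕ; zero; suc; _+_; _*_; _≤_; _<_)
open import Data.Nat.DivMod using (_/_; _%_)
open import Data.Product using (_×_; ∃-syntax)
open import Relation.Binary.PropositionalEquality using (_≡_)

-- Floor division and remainder, total in the divisor (value 0 for divisor 0;
-- every use in the statement has a provably nonzero divisor under the hypotheses).
divℕ : ℕ → ℕ → ℕ
divℕ m zero = zero
divℕ m (suc n) = m / suc n

modℕ : ℕ → ℕ → ℕ
modℕ m zero = m
modℕ m (suc n) = m % suc n

Rep : ℕ → ℕ → ℕ → Set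
Rep b c m = ∃[ n₁ ] ∃[ n₂ ] (m ≡ b * n₁ + c * n₂)

-- IsM a b c z m :  m = 𝐦(z), the least positive integer of the form
-- b n₁ + c n₂ congruent to z modulo a.
IsM : ℕ → ℕ → ℕ → ℕ → ℕ → Set
IsM a b c z m =
  0 < m × Rep b c m × modℕ m a ≡ modℕ z a ×
  (∀ m′ → 0 < m′ → Rep b c m′ → modℕ m′ a ≡ modℕ z a → m ≤ m′)

InX : ℕ → ℕ → ℕ → ℕ → ℕ → Set
InX a b c r x = 1 ≤ x × x ≤ r × ∃[ m ] (IsM a b c (b * x) m × modℕ m c ≡ 0)

-- Let d = a − ℓ. Since ℓ·b ≡ c (mod a), c ≡ −b·d, and as gcd(a, b) = 1 the congruence
-- b·y ≡ c·j (mod a) holds iff a ∣ y + d·j. Write a = q·d + r and d = s·r + u. The solutions of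
-- a ∣ y + d·j with 0 < y ≤ r are exactly the pairs (x_i, t_i), where x_i is the representative
-- of −u·i modulo r in {1, …, r} and t_i = i + q·(1 + ⌊u·i/r⌋ + s·i), and the floor hypotheses
-- say precisely that c·t_i < b·x_i for i ≤ μ and b·x_{μ+1} < c·t_{μ+1}. Subtracting (r, q)
-- from solutions shows that every solution (y, j) with 0 < j ≤ t_μ satisfies c·j ≤ b·y, so
-- 𝐦(b·x_i) = c·t_i for i ≤ μ; for i > μ, b·x_{μ+1} + c·(t_i − t_{μ+1}) undercuts c·t_i.
-- Hence 𝒳 = {x_0, …, x_μ}. The gap statements are combinatorics of the rotation:
-- x_{i+j} is x_i + x_j or x_i + x_j − r, and the latter is forced whenever i + j = μ + 1.

module Submission where

open import Defs
open import Data.Nat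
open import Data.Nat.Properties
open import Data.Nat.DivMod
open import Data.Nat.Divisibility
open import Data.Nat.Coprimality using (Coprime; coprime-divisor)
import Data.Nat.Coprimality as Coprimality
open import Data.Nat.Induction using (<-rec)
open import Data.Nat.Tactic.RingSolver using (solve-∀)
open import Data.Product
open import Data.Sum
open import Data.Empty
open import Relation.Nullary
open import Function.Bundles using (_⇔_; mk⇔; Equivalence)
open import Relation.Binary.PropositionalEquality
open import Relation.Binary.Definitions using (Tri; tri<; tri≈; tri>)
open import Algebra.Properties.CommutativeSemigroup +-commutativeSemigroup
  using (x∙yz≈y∙xz; xy∙z≈xz∙y; xy∙z≈zy∙x)
open import Algebra.Properties.CommutativeSemigroup *-commutativeSemigroup
  using () renaming (x∙yz≈y∙xz to *-x∙yz≈y∙xz)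

linear-combination : ∀ {L R A B} → L + B ≡ R + A → A ≡ B → L ≡ R
linear-combination {L} {R} {B = B} eq refl = +-cancelʳ-≡ B L R eq

divℕ≡/ : ∀ m n .{{_ : NonZero n}} → divℕ m n ≡ m / n
divℕ≡/ m (suc n) = refl

modℕ≡% : ∀ m n .{{_ : NonZero n}} → modℕ m n ≡ m % n
modℕ≡% m (suc n) = refl

divℕ-+-* : ∀ k m n .{{_ : NonZero n}} → divℕ (k * n + m) n ≡ k + divℕ m n
divℕ-+-* k m n = begin
  divℕ (k * n + m) n ≡⟨ divℕ≡/ (k * n + m) n ⟩
  (k * n + m) / n    ≡⟨ +-distrib-/-∣ˡ m (n∣m*n k) ⟩
  k * n / n + m / n  ≡⟨ cong₂ _+_ (m*n/n≡m k n) (sym (divℕ≡/ m n)) ⟩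
  k + divℕ m n       ∎
  where open ≡-Reasoning

divℕ-unique : ∀ {m n} k {ρ} .{{_ : NonZero n}} → m ≡ k * n + ρ → ρ < n → divℕ m n ≡ k
divℕ-unique {n = n} k {ρ} refl ρ<n = begin
  divℕ (k * n + ρ) n ≡⟨ divℕ-+-* k ρ n ⟩
  k + divℕ ρ n       ≡⟨ cong (k +_) (trans (divℕ≡/ ρ n) (m<n⇒m/n≡0 ρ<n)) ⟩
  k + 0              ≡⟨ +-identityʳ k ⟩
  k                  ∎
  where open ≡-Reasoning

divℕ*<suc : ∀ m n .{{_ : NonZero n}} → m < suc (divℕ m n) * n
divℕ*<suc m n = begin-strict
  m                   ≡⟨ m≡m%n+[m/n]*n m n ⟩
  m % n + m / n * n   <⟨ +-monoˡ-< (m / n * n) (m%n<n m n) ⟩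
  n + m / n * n       ≡⟨ cong (λ k → suc k * n) (divℕ≡/ m n) ⟨
  suc (divℕ m n) * n  ∎
  where open ≤-Reasoning

divℕ*≤ : ∀ m n .{{_ : NonZero n}} → divℕ m n * n ≤ m
divℕ*≤ m n = subst (λ k → k * n ≤ m) (sym (divℕ≡/ m n)) (m/n*n≤m m n)

divℕ≡⇔ : ∀ {m n} k .{{_ : NonZero n}} → k * n ≤ m → (divℕ m n ≡ k ⇔ m < suc k * n)
divℕ≡⇔ {m} {n} k kn≤m = mk⇔ (λ { refl → divℕ*<suc m n }) (λ m<[1+k]n →
  divℕ-unique k (sym (m+[n∸m]≡n kn≤m))
    (m<n+o⇒m∸n<o m (k * n) (subst (m <_) (+-comm n (k * n)) m<[1+k]n)))

+-<-exchange : ∀ {p y q z} → p + y ≡ q + z → (q < p ⇔ y < z)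
+-<-exchange {p} {y} {q} {z} p+y≡q+z = mk⇔
  (λ q<p → +-cancelˡ-< q y z (subst (q + y <_) p+y≡q+z (+-monoˡ-< y q<p)))
  (λ y<z → +-cancelʳ-< z q p (subst (_< p + z) p+y≡q+z (+-monoʳ-< p y<z)))

-- The space in `[mod a ]` is needed: `a]` would lex as a single name.
infix 4 _≡_[mod_]

_≡_[mod_] : ℕ → ℕ → ℕ → Set
_≡_[mod_] m n a = ∃[ k ] ∃[ k′ ] m + k * a ≡ n + k′ * a

modℕ⇒≡[mod] : ∀ {m n a} .{{_ : NonZero a}} → modℕ m a ≡ modℕ n a → m ≡ n [mod a ]
modℕ⇒≡[mod] {m} {n} {a} eq = divℕ n a , divℕ m a , (begin
  m + divℕ n a * a                   ≡⟨ cong (_+ divℕ n a * a) (m≡modℕ+divℕ* m) ⟩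
  modℕ m a + divℕ m a * a + divℕ n a * a ≡⟨ cong (λ k → k + divℕ m a * a + divℕ n a * a) eq ⟩
  modℕ n a + divℕ m a * a + divℕ n a * a ≡⟨ xy∙z≈xz∙y (modℕ n a) (divℕ m a * a) (divℕ n a * a) ⟩
  modℕ n a + divℕ n a * a + divℕ m a * a ≡⟨ cong (_+ divℕ m a * a) (m≡modℕ+divℕ* n) ⟨
  n + divℕ m a * a                   ∎)
  where
  open ≡-Reasoning
  m≡modℕ+divℕ* : ∀ m → m ≡ modℕ m a + divℕ m a * a
  m≡modℕ+divℕ* m = trans (m≡m%n+[m/n]*n m a)
    (sym (cong₂ (λ ρ k → ρ + k * a) (modℕ≡% m a) (divℕ≡/ m a)))

≡[mod]⇒modℕ : ∀ {m n a} .{{_ : NonZero a}} → m ≡ n [mod a ] → modℕ m a ≡ modℕ n a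
≡[mod]⇒modℕ {m} {n} {a} (k , k′ , eq) = begin
  modℕ m a            ≡⟨ modℕ≡% m a ⟩
  m % a               ≡⟨ [m+kn]%n≡m%n m k a ⟨
  (m + k * a) % a     ≡⟨ cong (_% a) eq ⟩
  (n + k′ * a) % a    ≡⟨ [m+kn]%n≡m%n n k′ a ⟩
  n % a               ≡⟨ modℕ≡% n a ⟨
  modℕ n a            ∎
  where open ≡-Reasoning

≡[mod]-sym : ∀ {m n a} → m ≡ n [mod a ] → n ≡ m [mod a ]
≡[mod]-sym (k , k′ , eq) = k′ , k , sym eq

≡[mod]-trans : ∀ {m n p a} → m ≡ n [mod a ] → n ≡ p [mod a ] → m ≡ p [mod a ]
≡[mod]-trans {m} {n} {p} {a} (k , k′ , m≡n) (l , l′ , n≡p) = k + l , k′ + l′ ,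
  linear-combination (identity m k l a n k′ p l′) (cong₂ _+_ m≡n n≡p)
  where
  identity : ∀ m k l a n k′ p l′ →
    m + (k + l) * a + (n + k′ * a + (p + l′ * a)) ≡ p + (k′ + l′) * a + (m + k * a + (n + l * a))
  identity = solve-∀

≡[mod]-+ʳ : ∀ {m n a} z → m ≡ n [mod a ] → m + z ≡ n + z [mod a ]
≡[mod]-+ʳ {m} {n} {a} z (k , k′ , eq) = k , k′ , (begin
  m + z + k * a ≡⟨ xy∙z≈xz∙y m z (k * a) ⟩
  m + k * a + z ≡⟨ cong (_+ z) eq ⟩
  n + k′ * a + z ≡⟨ xy∙z≈xz∙y n (k′ * a) z ⟩
  n + z + k′ * a ∎)
  where open ≡-Reasoning

≡[mod]-cancelʳ : ∀ {m n a} z → m + z ≡ n + z [mod a ] → m ≡ n [mod a ]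
≡[mod]-cancelʳ {m} {n} {a} z (k , k′ , eq) = k , k′ , +-cancelʳ-≡ z _ _ (begin
  m + k * a + z  ≡⟨ xy∙z≈xz∙y m (k * a) z ⟩
  m + z + k * a  ≡⟨ eq ⟩
  n + z + k′ * a ≡⟨ xy∙z≈xz∙y n z (k′ * a) ⟩
  n + k′ * a + z ∎)
  where open ≡-Reasoning

-- x i is the representative of −u·i modulo r in {1, …, r}.
module Rotation (r u : ℕ) .{{_ : NonZero r}} where

  f : ℕ → ℕ
  f i = divℕ (u * i) r

  x : ℕ → ℕ
  x i = r * suc (f i) ∸ u * i

  u*i<r*[1+f] : ∀ i → u * i < r * suc (f i)
  u*i<r*[1+f] i = subst (u * i <_) (*-comm (suc (f i)) r) (divℕ*<suc (u * i) r)

  x+u*i≡r*[1+f] : ∀ i → x i + u * i ≡ r * suc (f i)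
  x+u*i≡r*[1+f] i = m∸n+n≡m (<⇒≤ (u*i<r*[1+f] i))

  0<x : ∀ i → 0 < x i
  0<x i = m<n⇒0<n∸m (u*i<r*[1+f] i)

  x≤r : ∀ i → x i ≤ r
  x≤r i = +-cancelʳ-≤ (u * i) (x i) r (begin
    x i + u * i   ≡⟨ x+u*i≡r*[1+f] i ⟩
    r * suc (f i) ≡⟨ *-suc r (f i) ⟩
    r + r * f i   ≤⟨ +-monoʳ-≤ r (subst (_≤ u * i) (*-comm (f i) r) (divℕ*≤ (u * i) r)) ⟩
    r + u * i     ∎)
    where open ≤-Reasoning

  x-unique : ∀ {i y k} → 0 < y → y ≤ r → y + u * i ≡ r * suc k → f i ≡ k × x i ≡ y
  x-unique {i} {y} {k} 0<y y≤r eq = f≡k , x≡y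
    where
    identity : ∀ ui r y k z → ui + (r * suc k + (z + y)) ≡ k * r + z + (y + ui + r)
    identity = solve-∀
    f≡k : f i ≡ k
    f≡k = divℕ-unique k
      (linear-combination (identity (u * i) r y k (r ∸ y)) (cong₂ _+_ eq (sym (m∸n+n≡m y≤r))))
      (∸-monoʳ-< 0<y y≤r)
    x≡y : x i ≡ y
    x≡y = begin
      r * suc (f i) ∸ u * i ≡⟨ cong (λ k → r * suc k ∸ u * i) f≡k ⟩
      r * suc k ∸ u * i     ≡⟨ cong (_∸ u * i) eq ⟨
      y + u * i ∸ u * i     ≡⟨ m+n∸n≡m y (u * i) ⟩
      y                     ∎
      where open ≡-Reasoning

  x[0]≡r : x 0 ≡ r
  x[0]≡r = proj₂ (x-unique (>-nonZero⁻¹ r) ≤-refl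
    (trans (cong (r +_) (*-zeroʳ u)) (trans (+-identityʳ r) (sym (*-identityʳ r)))))

  f[0]≡0 : f 0 ≡ 0
  f[0]≡0 = trans (cong (λ k → divℕ k r) (*-zeroʳ u)) (trans (divℕ≡/ 0 r) (0/n≡0 r))

  x[1]+u≡r : u < r → x 1 + u ≡ r
  x[1]+u≡r u<r = trans (cong (_+ u) x[1]≡r∸u) (m∸n+n≡m (<⇒≤ u<r))
    where
    x[1]≡r∸u : x 1 ≡ r ∸ u
    x[1]≡r∸u = proj₂ (x-unique (m<n⇒0<n∸m u<r) (m∸n≤m r u)
      (trans (cong (r ∸ u +_) (*-identityʳ u)) (trans (m∸n+n≡m (<⇒≤ u<r)) (sym (*-identityʳ r)))))

  x-add-≤ : ∀ i j → x i + x j ≤ r → f (i + j) ≡ suc (f i + f j) × x (i + j) ≡ x i + x j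
  x-add-≤ i j sum≤r = x-unique (+-mono-≤ (0<x i) z≤n) sum≤r
    (linear-combination (identity (x i) (x j) u i j r (f i) (f j))
      (cong₂ _+_ (x+u*i≡r*[1+f] i) (x+u*i≡r*[1+f] j)))
    where
    identity : ∀ xi xj u i j r fi fj →
      xi + xj + u * (i + j) + (r * suc fi + r * suc fj) ≡ r * suc (suc (fi + fj)) + (xi + u * i + (xj + u * j))
    identity = solve-∀

  x-add-> : ∀ i j → r < x i + x j → x (i + j) + r ≡ x i + x j
  x-add-> i j r<sum = trans (cong (_+ r) (proj₂ (x-unique 0<y y≤r eq))) y+r≡sum
    where
    y = x i + x j ∸ r
    y+r≡sum : y + r ≡ x i + x j
    y+r≡sum = m∸n+n≡m (<⇒≤ r<sum)
    0<y : 0 < y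
    0<y = m<n⇒0<n∸m r<sum
    y≤r : y ≤ r
    y≤r = m≤n+o⇒m∸n≤o (x i + x j) r (+-mono-≤ (x≤r i) (x≤r j))
    identity : ∀ y xi xj u i j r fi fj →
      y + u * (i + j) + (r * suc fi + r * suc fj + (xi + xj)) ≡ r * suc (fi + fj) + (xi + u * i + (xj + u * j) + (y + r))
    identity = solve-∀
    eq : y + u * (i + j) ≡ r * suc (f i + f j)
    eq = linear-combination (identity y (x i) (x j) u i j r (f i) (f j))
           (cong₂ _+_ (cong₂ _+_ (x+u*i≡r*[1+f] i) (x+u*i≡r*[1+f] j)) y+r≡sum)

  f-mono : ∀ {i j} → i ≤ j → f i ≤ f j
  f-mono {i} {j} i≤j = subst₂ _≤_ (sym (divℕ≡/ (u * i) r)) (sym (divℕ≡/ (u * j) r))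
    (/-monoˡ-≤ r (*-monoʳ-≤ u i≤j))

  x≡r⇒r∣u*i : ∀ i → x i ≡ r → r ∣ u * i
  x≡r⇒r∣u*i i x≡r = divides (f i) (+-cancelˡ-≡ r _ _ (begin
    r + u * i       ≡⟨ cong (_+ u * i) x≡r ⟨
    x i + u * i     ≡⟨ x+u*i≡r*[1+f] i ⟩
    r * suc (f i)   ≡⟨ *-suc r (f i) ⟩
    r + r * f i     ≡⟨ cong (r +_) (*-comm r (f i)) ⟩
    r + f i * r     ∎))
    where open ≡-Reasoning

-- In the application x is Rotation.x, and r<x+x and x≢r come from the cone condition
-- c·t i < b·x i holding for i ≤ μ and failing at μ + 1.
module GapStructure (r u μ : ℕ) (x : ℕ → ℕ)
  (0<x : ∀ i → 0 < x i) (x≤r : ∀ i → x i ≤ r)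
  (x[0]≡r : x 0 ≡ r) (x[1]+u≡r : x 1 + u ≡ r) (0<u : 0 < u)
  (x-add-≤ : ∀ i j → x i + x j ≤ r → x (i + j) ≡ x i + x j)
  (x-add-> : ∀ i j → r < x i + x j → x (i + j) + r ≡ x i + x j)
  (r<x+x : ∀ i j → i ≤ μ → j ≤ μ → i + j ≡ suc μ → r < x i + x j)
  (x≢r : ∀ k → 0 < k → k ≤ μ → x k ≢ r)
  where

  x-add : ∀ {k j n} → k + j ≡ n → x n ≡ x k + x j ⊎ x n + r ≡ x k + x j
  x-add {k} {j} refl with x k + x j ≤? r
  ... | yes sum≤r = inj₁ (x-add-≤ k j sum≤r)
  ... | no sum≰r = inj₂ (x-add-> k j (≰⇒> sum≰r))

  x-increase⇒additive : ∀ {k j n} → k + j ≡ n → x j < x n → x n ≡ x k + x j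
  x-increase⇒additive {k} {j} {n} k+j≡n x[j]<x[n] with x-add k+j≡n
  ... | inj₁ fits = fits
  ... | inj₂ wraps = contradiction x[j]<x[n] (≤⇒≯ (+-cancelʳ-≤ r (x n) (x j) (begin
    x n + r   ≡⟨ wraps ⟩
    x k + x j ≤⟨ +-monoˡ-≤ (x j) (x≤r k) ⟩
    r + x j   ≡⟨ +-comm r (x j) ⟩
    x j + r   ∎)))
    where open ≤-Reasoning

  x-decrease⇒wraps : ∀ {k j n} → k + j ≡ n → x n < x j → x n + r ≡ x k + x j
  x-decrease⇒wraps {k} {j} {n} k+j≡n x[n]<x[j] with x-add k+j≡n
  ... | inj₂ wraps = wraps
  ... | inj₁ fits = contradiction x[n]<x[j] (≤⇒≯ (subst (x j ≤_) (sym fits) (m≤n+m (x j) (x k))))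

  x[μ+1]+r≡x+x : ∀ {i j} → i ≤ μ → j ≤ μ → i + j ≡ suc μ → x (suc μ) + r ≡ x i + x j
  x[μ+1]+r≡x+x {i} {j} i≤μ j≤μ i+j≡1+μ =
    subst (λ n → x n + r ≡ x i + x j) i+j≡1+μ (x-add-> i j (r<x+x i j i≤μ j≤μ i+j≡1+μ))

  x[1+i]+u≡x[i] : ∀ {i} → u < x i → x (suc i) + u ≡ x i
  x[1+i]+u≡x[i] {i} u<x[i] = +-cancelˡ-≡ (x 1) (x (suc i) + u) (x i) (begin
    x 1 + (x (suc i) + u) ≡⟨ x∙yz≈y∙xz (x 1) (x (suc i)) u ⟩
    x (suc i) + (x 1 + u) ≡⟨ cong (x (suc i) +_) x[1]+u≡r ⟩
    x (suc i) + r         ≡⟨ x-add-> 1 i (subst (_< x 1 + x i) x[1]+u≡r (+-monoʳ-< (x 1) u<x[i])) ⟩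
    x 1 + x i             ∎)
    where open ≡-Reasoning

  u<x[μ] : u < x μ
  u<x[μ] with μ ≟ 0
  ... | yes μ≡0 = subst (λ m → u < x m) (sym μ≡0)
    (subst (u <_) (trans x[1]+u≡r (sym x[0]≡r)) (m<n+m u (0<x 1)))
  ... | no μ≢0 = +-cancelˡ-< (x 1) u (x μ)
    (subst (_< x 1 + x μ) (sym x[1]+u≡r) (r<x+x 1 μ (n≢0⇒n>0 μ≢0) ≤-refl refl))

  x[μ+1]+u≡x[μ] : x (suc μ) + u ≡ x μ
  x[μ+1]+u≡x[μ] = x[1+i]+u≡x[i] u<x[μ]

  x[μ+1]<x : ∀ j → j ≤ μ → x (suc μ) < x j
  x[μ+1]<x zero _ = begin-strict
    x (suc μ)     <⟨ m<m+n (x (suc μ)) 0<u ⟩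
    x (suc μ) + u ≡⟨ x[μ+1]+u≡x[μ] ⟩
    x μ           ≤⟨ x≤r μ ⟩
    r             ≡⟨ x[0]≡r ⟨
    x 0           ∎
    where open ≤-Reasoning
  x[μ+1]<x (suc j) j<μ = +-cancelʳ-< r (x (suc μ)) (x (suc j)) (begin-strict
    x (suc μ) + r   ≡⟨ x[μ+1]+r≡x+x (m∸n≤m μ j) j<μ k+[1+j]≡1+μ ⟩
    x k + x (suc j) <⟨ +-monoˡ-< (x (suc j)) x[k]<r ⟩
    r + x (suc j)   ≡⟨ +-comm r (x (suc j)) ⟩
    x (suc j) + r   ∎)
    where
    open ≤-Reasoning
    k = μ ∸ j
    k+[1+j]≡1+μ : k + suc j ≡ suc μ
    k+[1+j]≡1+μ = trans (+-suc k j) (cong suc (m∸n+n≡m (<⇒≤ j<μ)))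
    x[k]<r : x k < r
    x[k]<r = ≤∧≢⇒< (x≤r k) (x≢r k (m<n⇒0<n∸m j<μ) (m∸n≤m μ j))

  u<x⇒x[μ]≤x : ∀ i → i ≤ μ → u < x i → x μ ≤ x i
  u<x⇒x[μ]≤x i i≤μ u<x[i] with m≤n⇒m<n∨m≡n i≤μ
  ... | inj₂ refl = ≤-refl
  ... | inj₁ i<μ = begin
    x μ           ≡⟨ x[μ+1]+u≡x[μ] ⟨
    x (suc μ) + u ≤⟨ +-monoˡ-≤ u (<⇒≤ (x[μ+1]<x (suc i) i<μ)) ⟩
    x (suc i) + u ≡⟨ x[1+i]+u≡x[i] u<x[i] ⟩
    x i           ∎
    where open ≤-Reasoning

  x-below : ∀ {i j} → j < i → x i < x j → x i + r ≡ x (i ∸ j) + x j × x (i ∸ j) < r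
  x-below {i} {j} j<i x[i]<x[j] = wraps , +-cancelʳ-< (x j) (x (i ∸ j)) r (begin-strict
    x (i ∸ j) + x j ≡⟨ wraps ⟨
    x i + r         <⟨ +-monoˡ-< r x[i]<x[j] ⟩
    x j + r         ≡⟨ +-comm (x j) r ⟩
    r + x j         ∎)
    where
    open ≤-Reasoning
    wraps : x i + r ≡ x (i ∸ j) + x j
    wraps = x-decrease⇒wraps (m∸n+n≡m (<⇒≤ j<i)) x[i]<x[j]

  module Minimum (î : ℕ) (î≤μ : î ≤ μ) (x[î]-min : ∀ k → k ≤ μ → x î ≤ x k) where

    x[m+î]≡x[m]+x[î] : ∀ m → m + î ≤ μ → x m < r → x (m + î) ≡ x m + x î
    x[m+î]≡x[m]+x[î] m m+î≤μ x[m]<r with x-add {m} {î} refl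
    ... | inj₁ fits = fits
    ... | inj₂ wraps = contradiction (x[î]-min (m + î) m+î≤μ)
      (<⇒≱ (+-cancelʳ-< r (x (m + î)) (x î) (begin-strict
        x (m + î) + r ≡⟨ wraps ⟩
        x m + x î     <⟨ +-monoˡ-< (x î) x[m]<r ⟩
        r + x î       ≡⟨ +-comm r (x î) ⟩
        x î + r       ∎)))
      where open ≤-Reasoning

    x[m]+x[î]≤r+x[μ+1] : ∀ m → m ≤ μ → x m < r → x m + x î ≤ r + x (suc μ)
    x[m]+x[î]≤r+x[μ+1] m m≤μ x[m]<r with x m + x î ≤? r + x (suc μ)
    ... | yes bounded = bounded
    ... | no unbounded = ⊥-elim (impossible (n ≤? μ))
      where
      n = m + î
      wraps : x n + r ≡ x m + x î
      wraps = x-add-> m î (≤-<-trans (m≤m+n r (x (suc μ))) (≰⇒> unbounded))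
      x[n]<x[î] : x n < x î
      x[n]<x[î] = +-cancelʳ-< r (x n) (x î) (begin-strict
        x n + r   ≡⟨ wraps ⟩
        x m + x î <⟨ +-monoˡ-< (x î) x[m]<r ⟩
        r + x î   ≡⟨ +-comm r (x î) ⟩
        x î + r   ∎)
        where open ≤-Reasoning
      x[μ+1]<x[n] : x (suc μ) < x n
      x[μ+1]<x[n] = +-cancelˡ-< r (x (suc μ)) (x n) (begin-strict
        r + x (suc μ) <⟨ ≰⇒> unbounded ⟩
        x m + x î     ≡⟨ wraps ⟨
        x n + r       ≡⟨ +-comm (x n) r ⟩
        r + x n       ∎)
        where open ≤-Reasoning
      impossible : Dec (n ≤ μ) → ⊥
      impossible (yes n≤μ) = <⇒≱ x[n]<x[î] (x[î]-min n n≤μ)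
      impossible (no n≰μ) = <⇒≱ (≤-<-trans x[n′]≤x[n] x[n]<x[î]) (x[î]-min n′ n′≤μ)
        where
        n′ = n ∸ suc μ
        n′+[1+μ]≡n : n′ + suc μ ≡ n
        n′+[1+μ]≡n = m∸n+n≡m (≰⇒> n≰μ)
        n′≤μ : n′ ≤ μ
        n′≤μ = +-cancelʳ-≤ (suc μ) n′ μ
          (subst (_≤ μ + suc μ) (sym n′+[1+μ]≡n) (+-mono-≤ m≤μ (m≤n⇒m≤1+n î≤μ)))
        x[n′]≤x[n] : x n′ ≤ x n
        x[n′]≤x[n] = subst (x n′ ≤_) (sym (x-increase⇒additive n′+[1+μ]≡n x[μ+1]<x[n]))
                       (m≤m+n (x n′) (x (suc μ)))

    x[i]+x[î]≤x[j] : ∀ {i j} → j ≤ μ → i < j → x i < x j → x i + x î ≤ x j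
    x[i]+x[î]≤x[j] {i} {j} j≤μ i<j x[i]<x[j] = begin
      x i + x î       ≤⟨ +-monoʳ-≤ (x i) (x[î]-min (j ∸ i) (≤-trans (m∸n≤m j i) j≤μ)) ⟩
      x i + x (j ∸ i) ≡⟨ +-comm (x i) (x (j ∸ i)) ⟩
      x (j ∸ i) + x i ≡⟨ x-increase⇒additive (m∸n+n≡m (<⇒≤ i<j)) x[i]<x[j] ⟨
      x j             ∎
      where open ≤-Reasoning

    x[i]+x[î]≡x[m]+x[μ+1] : ∀ {i} → i ≤ μ → x i < r → μ < i + î →
                            ∃[ m ] m ≤ μ × x i + x î ≡ x m + x (suc μ)
    x[i]+x[î]≡x[m]+x[μ+1] {i} i≤μ x[i]<r μ<i+î = m , ≤-trans (m∸n≤m i k) i≤μ ,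
      +-cancelʳ-≡ r (x i + x î) (x m + x (suc μ)) (begin-equality
        x i + x î + r         ≡⟨ xy∙z≈xz∙y (x i) (x î) r ⟩
        x i + r + x î         ≡⟨ cong (_+ x î) wraps ⟩
        x m + x k + x î       ≡⟨ +-assoc (x m) (x k) (x î) ⟩
        x m + (x k + x î)     ≡⟨ cong (x m +_) x[μ+1]+r≡x[k]+x[î] ⟨
        x m + (x (suc μ) + r) ≡⟨ +-assoc (x m) (x (suc μ)) r ⟨
        x m + x (suc μ) + r   ∎)
      where
      open ≤-Reasoning
      k = suc μ ∸ î
      k+î≡1+μ : k + î ≡ suc μ
      k+î≡1+μ = m∸n+n≡m (m≤n⇒m≤1+n î≤μ)
      k≤i : k ≤ i
      k≤i = +-cancelʳ-≤ î k i (subst (_≤ i + î) (sym k+î≡1+μ) μ<i+î)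
      x[μ+1]+r≡x[k]+x[î] : x (suc μ) + r ≡ x k + x î
      x[μ+1]+r≡x[k]+x[î] = x[μ+1]+r≡x+x (≤-trans k≤i i≤μ) î≤μ k+î≡1+μ
      m = i ∸ k
      wraps : x i + r ≡ x m + x k
      wraps with x-add (m∸n+n≡m k≤i)
      ... | inj₂ wraps = wraps
      ... | inj₁ fits = contradiction (x[m]+x[î]≤r+x[μ+1] i i≤μ x[i]<r) (<⇒≱ (begin-strict
        r + x (suc μ)         <⟨ m<n+m (r + x (suc μ)) (0<x m) ⟩
        x m + (r + x (suc μ)) ≡⟨ cong (x m +_) (trans (+-comm r (x (suc μ))) x[μ+1]+r≡x[k]+x[î]) ⟩
        x m + (x k + x î)     ≡⟨ +-assoc (x m) (x k) (x î) ⟨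
        x m + x k + x î       ≡⟨ cong (_+ x î) fits ⟨
        x i + x î             ∎))

    module _ {i j} (i≤μ : i ≤ μ) (j≤μ : j ≤ μ) (x[i]<x[j] : x i < x j)
             (x[j]-next : ∀ k → k ≤ μ → x i < x k → x j ≤ x k) where

      x[i]<r : x i < r
      x[i]<r = <-≤-trans x[i]<x[j] (x≤r j)

      gap-within : i + î ≤ μ → x j ≡ x i + x î
      gap-within i+î≤μ = ≤-antisym upper (lower (<-cmp i j))
        where
        open ≤-Reasoning
        fits : x (i + î) ≡ x i + x î
        fits = x[m+î]≡x[m]+x[î] i i+î≤μ x[i]<r
        upper : x j ≤ x i + x î
        upper = subst (x j ≤_) fits
          (x[j]-next (i + î) i+î≤μ (subst (x i <_) (sym fits) (m<m+n (x i) (0<x î))))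
        lower : Tri (i < j) (i ≡ j) (j < i) → x i + x î ≤ x j
        lower (tri< i<j _ _) = x[i]+x[î]≤x[j] j≤μ i<j x[i]<x[j]
        lower (tri≈ _ refl _) = contradiction x[i]<x[j] (<-irrefl refl)
        lower (tri> _ _ j<i) = +-cancelʳ-≤ r (x i + x î) (x j) (begin
          x i + x î + r   ≡⟨ xy∙z≈xz∙y (x i) (x î) r ⟩
          x i + r + x î   ≡⟨ cong (_+ x î) (proj₁ (x-below j<i x[i]<x[j])) ⟩
          x k + x j + x î ≡⟨ xy∙z≈xz∙y (x k) (x j) (x î) ⟩
          x k + x î + x j ≡⟨ cong (_+ x j) (x[m+î]≡x[m]+x[î] k k+î≤μ (proj₂ (x-below j<i x[i]<x[j]))) ⟨
          x (k + î) + x j ≤⟨ +-monoˡ-≤ (x j) (x≤r (k + î)) ⟩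
          r + x j         ≡⟨ +-comm r (x j) ⟩
          x j + r         ∎)
          where
          k = i ∸ j
          k+î≤μ : k + î ≤ μ
          k+î≤μ = ≤-trans (+-monoˡ-≤ î (m∸n≤m i j)) i+î≤μ

      gap-beyond : μ < i + î → x j + x (suc μ) ≡ x i + x î
      gap-beyond μ<i+î = ≤-antisym upper (lower (<-cmp i j))
        where
        open ≤-Reasoning
        partner = x[i]+x[î]≡x[m]+x[μ+1] i≤μ x[i]<r μ<i+î
        m = proj₁ partner
        x[i]+x[î]≡ : x i + x î ≡ x m + x (suc μ)
        x[i]+x[î]≡ = proj₂ (proj₂ partner)
        x[i]<x[m] : x i < x m
        x[i]<x[m] = +-cancelʳ-< (x î) (x i) (x m) (begin-strict
          x i + x î       ≡⟨ x[i]+x[î]≡ ⟩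
          x m + x (suc μ) <⟨ +-monoʳ-< (x m) (x[μ+1]<x î î≤μ) ⟩
          x m + x î       ∎)
        upper : x j + x (suc μ) ≤ x i + x î
        upper = subst (x j + x (suc μ) ≤_) (sym x[i]+x[î]≡)
          (+-monoˡ-≤ (x (suc μ)) (x[j]-next m (proj₁ (proj₂ partner)) x[i]<x[m]))
        lower : Tri (i < j) (i ≡ j) (j < i) → x i + x î ≤ x j + x (suc μ)
        lower (tri< i<j _ _) = contradiction (x[i]+x[î]≤x[j] j≤μ i<j x[i]<x[j])
          (<⇒≱ (<-≤-trans (m<m+n (x j) (0<x (suc μ))) upper))
        lower (tri≈ _ refl _) = contradiction x[i]<x[j] (<-irrefl refl)
        lower (tri> _ _ j<i) = +-cancelʳ-≤ r (x i + x î) (x j + x (suc μ)) (begin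
          x i + x î + r       ≡⟨ xy∙z≈xz∙y (x i) (x î) r ⟩
          x i + r + x î       ≡⟨ cong (_+ x î) (proj₁ (x-below j<i x[i]<x[j])) ⟩
          x k + x j + x î     ≡⟨ xy∙z≈xz∙y (x k) (x j) (x î) ⟩
          x k + x î + x j     ≤⟨ +-monoˡ-≤ (x j) (x[m]+x[î]≤r+x[μ+1] k k≤μ (proj₂ (x-below j<i x[i]<x[j]))) ⟩
          r + x (suc μ) + x j ≡⟨ xy∙z≈zy∙x r (x (suc μ)) (x j) ⟩
          x j + x (suc μ) + r ∎)
          where
          k = i ∸ j
          k≤μ : k ≤ μ
          k≤μ = ≤-trans (m∸n≤m i j) i≤μ

      consecutive-gap : x j ≡ x i + x î ⊎ x j + x (suc μ) ≡ x i + x î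
      consecutive-gap with i + î ≤? μ
      ... | yes within = inj₁ (gap-within within)
      ... | no beyond = inj₂ (gap-beyond (≰⇒> beyond))

  module Enumeration (S : ℕ → Set) (S⇒x : ∀ {y} → S y → ∃[ i ] i ≤ μ × y ≡ x i)
                     (x∈S : ∀ i → i ≤ μ → S (x i)) where

    x[μ]-least-above-u : ∀ y → S y → u < y → x μ ≤ y
    x[μ]-least-above-u y y∈S u<y with S⇒x y∈S
    ... | i , i≤μ , refl = u<x⇒x[μ]≤x i i≤μ u<y

    consecutive-gaps : ∀ x̂ → S x̂ → (∀ y → S y → x̂ ≤ y) →
      ∀ y z → S y → S z → y < z → (∀ w → S w → y < w → z ≤ w) →
      z ≡ y + x̂ ⊎ z + x (suc μ) ≡ y + x̂
    consecutive-gaps x̂ x̂∈S x̂-least y z y∈S z∈S y<z z-next with S⇒x x̂∈S | S⇒x y∈S | S⇒x z∈S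
    ... | î , î≤μ , refl | i , i≤μ , refl | j , j≤μ , refl =
      Minimum.consecutive-gap î î≤μ (λ k k≤μ → x̂-least (x k) (x∈S k k≤μ)) i≤μ j≤μ y<z
        (λ k k≤μ x[i]<x[k] → z-next (x k) (x∈S k k≤μ) x[i]<x[k])

module Lattice (a d q s r u : ℕ) .{{_ : NonZero r}} .{{_ : NonZero d}}
               (a≡q*d+r : a ≡ q * d + r) (d≡s*r+u : d ≡ s * r + u) where

  open Rotation r u public

  -- The pairs (x i, t i) are the solutions of a ∣ n + d·j with 0 < n ≤ r (x+d*t≡a*M, lattice-point).
  M : ℕ → ℕ
  M i = suc (f i + s * i)

  t : ℕ → ℕ
  t i = i + q * M i

  x+d*i≡r*M : ∀ i → x i + d * i ≡ r * M i
  x+d*i≡r*M i = linear-combination (identity (x i) d i u r s (f i))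
    (cong₂ _+_ (x+u*i≡r*[1+f] i) (cong (_* i) d≡s*r+u))
    where
    identity : ∀ x d i u r s f →
      x + d * i + (r * suc f + (s * r + u) * i) ≡ r * suc (f + s * i) + (x + u * i + d * i)
    identity = solve-∀

  x+d*t≡a*M : ∀ i → x i + d * t i ≡ a * M i
  x+d*t≡a*M i = linear-combination (identity (x i) d i q (M i) r a)
    (cong₂ _+_ (x+d*i≡r*M i) (cong (_* M i) (sym a≡q*d+r)))
    where
    identity : ∀ x d i q m r a → x + d * (i + q * m) + (r * m + a * m) ≡ a * m + (x + d * i + (q * d + r) * m)
    identity = solve-∀

  M-unique : ∀ {i n m} → 0 < n → n ≤ r → n + d * i ≡ r * m → x i ≡ n × M i ≡ m
  M-unique {i} {n} {m} 0<n n≤r n+d*i≡r*m = proj₂ x-f-unique , M≡m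
    where
    n+u*i+r*s*i≡r*m : n + u * i + r * (s * i) ≡ r * m
    n+u*i+r*s*i≡r*m = linear-combination (identity n u i r s d m)
      (cong₂ _+_ n+d*i≡r*m (cong (_* i) (sym d≡s*r+u)))
      where
      identity : ∀ n u i r s d m → n + u * i + r * (s * i) + (r * m + d * i) ≡ r * m + (n + d * i + (s * r + u) * i)
      identity = solve-∀
    s*i<m : s * i < m
    s*i<m = *-cancelˡ-< r (s * i) m (begin-strict
      r * (s * i)             <⟨ m<n+m (r * (s * i)) (+-mono-≤ 0<n z≤n) ⟩
      n + u * i + r * (s * i) ≡⟨ n+u*i+r*s*i≡r*m ⟩
      r * m                   ∎)
      where open ≤-Reasoning
    k = m ∸ suc (s * i)
    1+k+s*i≡m : suc (k + s * i) ≡ m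
    1+k+s*i≡m = trans (sym (+-suc k (s * i))) (m∸n+n≡m s*i<m)
    x-f-unique : f i ≡ k × x i ≡ n
    x-f-unique = x-unique 0<n n≤r (+-cancelʳ-≡ (r * (s * i)) (n + u * i) (r * suc k) (begin
      n + u * i + r * (s * i) ≡⟨ n+u*i+r*s*i≡r*m ⟩
      r * m                   ≡⟨ cong (r *_) 1+k+s*i≡m ⟨
      r * suc (k + s * i)     ≡⟨ *-distribˡ-+ r (suc k) (s * i) ⟩
      r * suc k + r * (s * i) ∎))
      where open ≡-Reasoning
    M≡m : M i ≡ m
    M≡m = trans (cong (λ k → suc (k + s * i)) (proj₁ x-f-unique)) 1+k+s*i≡m

  lattice-point : ∀ {n j m} → 0 < n → n ≤ r → n + d * j ≡ m * a → ∃[ i ] x i ≡ n × t i ≡ j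
  lattice-point {n} {j} {zero} 0<n _ n+d*j≡0 =
    contradiction (m+n≡0⇒m≡0 n n+d*j≡0) (≢-nonZero⁻¹ n {{>-nonZero 0<n}})
  lattice-point {n} {j} {m@(suc _)} 0<n n≤r n+d*j≡m*a = i , proj₁ unique , t≡j
    where
    n+d*j≡d*[q*m]+r*m : n + d * j ≡ d * (q * m) + r * m
    n+d*j≡d*[q*m]+r*m = trans n+d*j≡m*a (linear-combination (identity m a q d r) (cong (m *_) a≡q*d+r))
      where
      identity : ∀ m a q d r → m * a + m * (q * d + r) ≡ d * (q * m) + r * m + m * a
      identity = solve-∀
    q*m≤j : q * m ≤ j
    q*m≤j = *-cancelˡ-≤ d (+-cancelʳ-≤ n (d * (q * m)) (d * j) (begin
      d * (q * m) + n     ≤⟨ +-monoʳ-≤ (d * (q * m)) (≤-trans n≤r (m≤m*n r m)) ⟩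
      d * (q * m) + r * m ≡⟨ n+d*j≡d*[q*m]+r*m ⟨
      n + d * j           ≡⟨ +-comm n (d * j) ⟩
      d * j + n           ∎))
      where open ≤-Reasoning
    i = j ∸ q * m
    i+q*m≡j : i + q * m ≡ j
    i+q*m≡j = m∸n+n≡m q*m≤j
    unique : x i ≡ n × M i ≡ m
    unique = M-unique 0<n n≤r (+-cancelʳ-≡ (d * (q * m)) (n + d * i) (r * m) (begin
      n + d * i + d * (q * m) ≡⟨ +-assoc n (d * i) (d * (q * m)) ⟩
      n + (d * i + d * (q * m)) ≡⟨ cong (n +_) (*-distribˡ-+ d i (q * m)) ⟨
      n + d * (i + q * m)     ≡⟨ cong (λ k → n + d * k) i+q*m≡j ⟩
      n + d * j               ≡⟨ n+d*j≡d*[q*m]+r*m ⟩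
      d * (q * m) + r * m     ≡⟨ +-comm (d * (q * m)) (r * m) ⟩
      r * m + d * (q * m)     ∎))
      where open ≡-Reasoning
    t≡j : t i ≡ j
    t≡j = trans (cong (λ k → i + q * k) (proj₂ unique)) i+q*m≡j

  a∣[n+r]+d*[j+q]⇒a∣n+d*j : ∀ {n j} → a ∣ (n + r) + d * (j + q) → a ∣ n + d * j
  a∣[n+r]+d*[j+q]⇒a∣n+d*j {n} {j} a∣ = ∣m+n∣m⇒∣n (subst (a ∣_) shift a∣) ∣-refl
    where
    identity : ∀ n r d j q a → n + r + d * (j + q) + a ≡ a + (n + d * j) + (q * d + r)
    identity = solve-∀
    shift : n + r + d * (j + q) ≡ a + (n + d * j)
    shift = linear-combination (identity n r d j q a) (sym a≡q*d+r)

  M-mono : ∀ {i j} → i ≤ j → M i ≤ M j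
  M-mono i≤j = s≤s (+-mono-≤ (f-mono i≤j) (*-monoʳ-≤ s i≤j))

  t-mono-≤ : ∀ {i j} → i ≤ j → t i ≤ t j
  t-mono-≤ i≤j = +-mono-≤ i≤j (*-monoʳ-≤ q (M-mono i≤j))

  t-mono-< : ∀ {i j} → i < j → t i < t j
  t-mono-< i<j = +-mono-<-≤ i<j (*-monoʳ-≤ q (M-mono (<⇒≤ i<j)))

  t-add-≤ : ∀ i j → x i + x j ≤ r → t (i + j) ≡ t i + t j
  t-add-≤ i j sum≤r = begin
    t (i + j)                                       ≡⟨ cong (λ k → i + j + q * suc (k + s * (i + j)))
                                                           (proj₁ (x-add-≤ i j sum≤r)) ⟩
    i + j + q * suc (suc (f i + f j) + s * (i + j)) ≡⟨ identity i j q (f i) (f j) s ⟩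
    t i + t j                                       ∎
    where
    open ≡-Reasoning
    identity : ∀ i j q fi fj s →
      i + j + q * suc (suc (fi + fj) + s * (i + j)) ≡ i + q * suc (fi + s * i) + (j + q * suc (fj + s * j))
    identity = solve-∀

  t[0]≡q : t 0 ≡ q
  t[0]≡q = trans (cong₂ (λ k l → q * suc (k + l)) f[0]≡0 (*-zeroʳ s)) (*-identityʳ q)

  t-cancel-≤ : ∀ {i j} → t i ≤ t j → i ≤ j
  t-cancel-≤ t[i]≤t[j] = ≮⇒≥ λ j<i → <⇒≱ (t-mono-< j<i) t[i]≤t[j]

  q≤t : ∀ i → q ≤ t i
  q≤t i = ≤-trans (m≤m*n q (M i)) (m≤n+m (q * M i) i)

module LinearCongruence (a b c d : ℕ) (a∣c+b*d : a ∣ c + b * d) where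

  open _∣_ a∣c+b*d renaming (quotient to K; equality to c+b*d≡K*a)

  ∣⇒≡[mod] : ∀ {y j} → a ∣ y + d * j → c * j ≡ b * y [mod a ]
  ∣⇒≡[mod] {y} {j} (divides m y+d*j≡m*a) = b * m , j * K ,
    linear-combination (identity a b c d j y m K)
      (cong₂ _+_ (sym (cong (b *_) y+d*j≡m*a)) (cong (j *_) c+b*d≡K*a))
    where
    identity : ∀ a b c d j y m K →
      c * j + b * m * a + (b * (y + d * j) + j * (K * a)) ≡ b * y + j * K * a + (b * (m * a) + j * (c + b * d))
    identity = solve-∀

  ≡[mod]⇒∣ : Coprime a b → ∀ {y j} → b * y ≡ c * j [mod a ] → a ∣ y + d * j
  ≡[mod]⇒∣ coprime {y} {j} (k , k′ , b*y+k*a≡c*j+k′*a) =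
    coprime-divisor coprime (∣m+n∣m⇒∣n
      (divides (j * K + k′) (linear-combination (identity a b c d j y k k′ K)
        (cong₂ _+_ b*y+k*a≡c*j+k′*a (cong (j *_) c+b*d≡K*a))))
      (n∣m*n k))
    where
    identity : ∀ a b c d j y k k′ K →
      k * a + b * (y + d * j) + (c * j + k′ * a + j * (K * a)) ≡ (j * K + k′) * a + (b * y + k * a + j * (c + b * d))
    identity = solve-∀

module Representation (a b c d q s r u : ℕ) .{{_ : NonZero r}} .{{_ : NonZero d}}
  (a≡q*d+r : a ≡ q * d + r) (d≡s*r+u : d ≡ s * r + u) (a∣c+b*d : a ∣ c + b * d)
  (coprime[a,b] : Coprime a b) (coprime[a,d] : Coprime a d) (coprime[r,u] : Coprime r u)
  (a<b : a < b) (b<c : b < c) (0<q : 0 < q) (0<u : 0 < u) (u<r : u < r)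
  where

  open Lattice a d q s r u a≡q*d+r d≡s*r+u
  open LinearCongruence a b c d a∣c+b*d

  r≤a : r ≤ a
  r≤a = subst (r ≤_) (sym a≡q*d+r) (m≤n+m r (q * d))

  instance
    a-nonZero : NonZero a
    a-nonZero = >-nonZero (<-≤-trans (>-nonZero⁻¹ r) r≤a)
    c-nonZero : NonZero c
    c-nonZero = >-nonZero (<-trans (≤-<-trans z≤n a<b) b<c)

  c*t≡b*x : ∀ i → c * t i ≡ b * x i [mod a ]
  c*t≡b*x i = ∣⇒≡[mod] (divides (M i) (trans (x+d*t≡a*M i) (*-comm a (M i))))

  lattice-index : ∀ {y T} → 0 < y → y ≤ r → b * y ≡ c * T [mod a ] → ∃[ i ] x i ≡ y × t i ≡ T
  lattice-index 0<y y≤r b*y≡c*T with ≡[mod]⇒∣ coprime[a,b] b*y≡c*T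
  ... | divides k y+d*T≡k*a = lattice-point {m = k} 0<y y≤r y+d*T≡k*a

  InX⇒lattice : ∀ {y} → InX a b c r y → ∃[ i ] y ≡ x i × IsM a b c (b * x i) (c * t i)
  InX⇒lattice {y} (0<y , y≤r , m , least@(_ , _ , m≡b*y , _) , m%c≡0) =
    let divides T m≡T*c = m%n≡0⇒n∣m m c (trans (sym (modℕ≡% m c)) m%c≡0)
        m≡c*T = trans m≡T*c (*-comm T c)
        i , x≡y , t≡T = lattice-index 0<y y≤r
          (subst (λ k → b * y ≡ k [mod a ]) m≡c*T (≡[mod]-sym (modℕ⇒≡[mod] m≡b*y)))
    in i , sym x≡y , subst₂ (IsM a b c) (cong (b *_) (sym x≡y)) (trans m≡c*T (cong (c *_) (sym t≡T))) least

  module _ (μ : ℕ) (cone : ∀ i → i ≤ μ → c * t i < b * x i)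
           (beyond : b * x (suc μ) < c * t (suc μ)) where

    r<x+x : ∀ i j → i ≤ μ → j ≤ μ → i + j ≡ suc μ → r < x i + x j
    r<x+x i j i≤μ j≤μ i+j≡1+μ = ≰⇒> λ sum≤r → <⇒≱ beyond (begin
      c * t (suc μ)     ≡⟨ cong (λ n → c * t n) i+j≡1+μ ⟨
      c * t (i + j)     ≡⟨ cong (c *_) (t-add-≤ i j sum≤r) ⟩
      c * (t i + t j)   ≡⟨ *-distribˡ-+ c (t i) (t j) ⟩
      c * t i + c * t j ≤⟨ <⇒≤ (+-mono-< (cone i i≤μ) (cone j j≤μ)) ⟩
      b * x i + b * x j ≡⟨ *-distribˡ-+ b (x i) (x j) ⟨
      b * (x i + x j)   ≡⟨ cong (b *_) (proj₂ (x-add-≤ i j sum≤r)) ⟨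
      b * x (i + j)     ≡⟨ cong (λ n → b * x n) i+j≡1+μ ⟩
      b * x (suc μ)     ∎)
      where open ≤-Reasoning

    x≢r : ∀ k → 0 < k → k ≤ μ → x k ≢ r
    x≢r k 0<k k≤μ x≡r = <⇒≱ (cone k k≤μ) (begin
      b * x k ≡⟨ cong (b *_) x≡r ⟩
      b * r   ≤⟨ *-monoˡ-≤ r (<⇒≤ b<c) ⟩
      c * r   ≤⟨ *-monoʳ-≤ c (≤-trans r≤k (m≤m+n k (q * M k))) ⟩
      c * t k ∎)
      where
      open ≤-Reasoning
      r≤k : r ≤ k
      r≤k = ∣⇒≤ {{>-nonZero 0<k}} (coprime-divisor coprime[r,u] (x≡r⇒r∣u*i k x≡r))

    t[μ]<a : t μ < a
    t[μ]<a = *-cancelˡ-< c (t μ) a (begin-strict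
      c * t μ <⟨ cone μ ≤-refl ⟩
      b * x μ ≤⟨ *-monoʳ-≤ b (≤-trans (x≤r μ) r≤a) ⟩
      b * a   ≤⟨ *-monoˡ-≤ a (<⇒≤ b<c) ⟩
      c * a   ∎)
      where open ≤-Reasoning

    c*q<b*r : c * q < b * r
    c*q<b*r = subst₂ (λ k l → c * k < b * l) t[0]≡q x[0]≡r (cone 0 z≤n)

    -- Subtracting (r, q) keeps (n, j) a solution, as a = q·d + r; this reduces to n ≤ r,
    -- where (n, j) = (x i, t i) for some i ≤ μ.
    c*j≤b*n : ∀ n {j} → 0 < j → j ≤ t μ → a ∣ n + d * j → c * j ≤ b * n
    c*j≤b*n = <-rec Bounded step
      where
      Bounded : ℕ → Set
      Bounded n = ∀ {j} → 0 < j → j ≤ t μ → a ∣ n + d * j → c * j ≤ b * n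
      step : ∀ n → (∀ {n′} → n′ < n → Bounded n′) → Bounded n
      step zero _ 0<j j≤t[μ] a∣d*j = contradiction
        (≤-trans (∣⇒≤ {{>-nonZero 0<j}} (coprime-divisor coprime[a,d] a∣d*j)) j≤t[μ]) (<⇒≱ t[μ]<a)
      step n@(suc _) rec {j} 0<j j≤t[μ] a∣n+d*j@(divides m n+d*j≡m*a) with n ≤? r | j ≤? q
      ... | yes n≤r | _ with lattice-point {m = m} z<s n≤r n+d*j≡m*a
      ...   | i , x≡n , t≡j = <⇒≤ (subst₂ (λ k l → c * k < b * l) t≡j x≡n
                                     (cone i (t-cancel-≤ (subst (_≤ t μ) (sym t≡j) j≤t[μ]))))
      step n@(suc _) rec {j} 0<j j≤t[μ] a∣n+d*j | no n≰r | yes j≤q = begin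
        c * j ≤⟨ *-monoʳ-≤ c j≤q ⟩
        c * q ≤⟨ <⇒≤ c*q<b*r ⟩
        b * r ≤⟨ *-monoʳ-≤ b (<⇒≤ (≰⇒> n≰r)) ⟩
        b * n ∎
        where open ≤-Reasoning
      step n@(suc _) rec {j} 0<j j≤t[μ] a∣n+d*j | no n≰r | no j≰q = begin
        c * j             ≡⟨ cong (c *_) j′+q≡j ⟨
        c * (j′ + q)      ≡⟨ *-distribˡ-+ c j′ q ⟩
        c * j′ + c * q    ≤⟨ +-mono-≤ (rec n′<n (m<n⇒0<n∸m (≰⇒> j≰q)) j′≤t[μ] a∣n′+d*j′) (<⇒≤ c*q<b*r) ⟩
        b * n′ + b * r    ≡⟨ *-distribˡ-+ b n′ r ⟨
        b * (n′ + r)      ≡⟨ cong (b *_) n′+r≡n ⟩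
        b * n             ∎
        where
        open ≤-Reasoning
        n′ = n ∸ r
        j′ = j ∸ q
        n′+r≡n : n′ + r ≡ n
        n′+r≡n = m∸n+n≡m (<⇒≤ (≰⇒> n≰r))
        j′+q≡j : j′ + q ≡ j
        j′+q≡j = m∸n+n≡m (<⇒≤ (≰⇒> j≰q))
        n′<n : n′ < n
        n′<n = ∸-monoʳ-< (>-nonZero⁻¹ r) (<⇒≤ (≰⇒> n≰r))
        j′≤t[μ] : j′ ≤ t μ
        j′≤t[μ] = ≤-trans (m∸n≤m j q) j≤t[μ]
        a∣n′+d*j′ : a ∣ n′ + d * j′
        a∣n′+d*j′ = a∣[n+r]+d*[j+q]⇒a∣n+d*j
          (subst₂ (λ k l → a ∣ k + d * l) (sym n′+r≡n) (sym j′+q≡j) a∣n+d*j)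

    c*t-least : ∀ i → i ≤ μ → IsM a b c (b * x i) (c * t i)
    c*t-least i i≤μ = *-mono-< (>-nonZero⁻¹ c) (<-≤-trans 0<q (q≤t i))
                    , (0 , t i , cong (_+ c * t i) (sym (*-zeroʳ b)))
                    , ≡[mod]⇒modℕ (c*t≡b*x i)
                    , least
      where
      least : ∀ m′ → 0 < m′ → Rep b c m′ → modℕ m′ a ≡ modℕ (b * x i) a → c * t i ≤ m′
      least _ _ (n₁ , n₂ , refl) ≡b*x with t i ≤? n₂
      ... | yes t≤n₂ = ≤-trans (*-monoʳ-≤ c t≤n₂) (m≤n+m (c * n₂) (b * n₁))
      ... | no t≰n₂ = begin
        c * t i         ≡⟨ cong (c *_) j+n₂≡t ⟨
        c * (j + n₂)    ≡⟨ *-distribˡ-+ c j n₂ ⟩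
        c * j + c * n₂  ≤⟨ +-monoˡ-≤ (c * n₂) (c*j≤b*n n₁ (m<n⇒0<n∸m (≰⇒> t≰n₂)) j≤t[μ] a∣n₁+d*j) ⟩
        b * n₁ + c * n₂ ∎
        where
        open ≤-Reasoning
        j = t i ∸ n₂
        j+n₂≡t : j + n₂ ≡ t i
        j+n₂≡t = m∸n+n≡m (<⇒≤ (≰⇒> t≰n₂))
        j≤t[μ] : j ≤ t μ
        j≤t[μ] = ≤-trans (m∸n≤m (t i) n₂) (t-mono-≤ i≤μ)
        a∣n₁+d*j : a ∣ n₁ + d * j
        a∣n₁+d*j = ≡[mod]⇒∣ coprime[a,b] (≡[mod]-cancelʳ (c * n₂) (≡[mod]-trans (modℕ⇒≡[mod] ≡b*x)
          (subst (λ k → b * x i ≡ k [mod a ]) (trans (cong (c *_) (sym j+n₂≡t)) (*-distribˡ-+ c j n₂))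
            (≡[mod]-sym (c*t≡b*x i)))))

    x∈X : ∀ i → i ≤ μ → InX a b c r (x i)
    x∈X i i≤μ = 0<x i , x≤r i , c * t i , c*t-least i i≤μ
              , trans (modℕ≡% (c * t i) c) (n∣m⇒m%n≡0 (c * t i) c (m∣m*n (t i)))

    -- Trading c·t (suc μ) for the smaller, congruent b·x (suc μ) undercuts c·t i.
    not-least-beyond : ∀ i → μ < i → ¬ IsM a b c (b * x i) (c * t i)
    not-least-beyond i μ<i (_ , _ , _ , least) = <⇒≱ m′<c*t (least m′ 0<m′ (x (suc μ) , Z , refl) m′≡b*x)
      where
      Z = t i ∸ t (suc μ)
      m′ = b * x (suc μ) + c * Z
      c*t[1+μ]+c*Z≡c*t : c * t (suc μ) + c * Z ≡ c * t i
      c*t[1+μ]+c*Z≡c*t = trans (sym (*-distribˡ-+ c (t (suc μ)) Z)) (cong (c *_) (m+[n∸m]≡n (t-mono-≤ μ<i)))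
      0<m′ : 0 < m′
      0<m′ = <-≤-trans (*-mono-< (≤-<-trans z≤n a<b) (0<x (suc μ))) (m≤m+n (b * x (suc μ)) (c * Z))
      m′<c*t : m′ < c * t i
      m′<c*t = subst (m′ <_) c*t[1+μ]+c*Z≡c*t (+-monoˡ-< (c * Z) beyond)
      m′≡b*x : modℕ m′ a ≡ modℕ (b * x i) a
      m′≡b*x = ≡[mod]⇒modℕ (≡[mod]-trans (≡[mod]-+ʳ (c * Z) (≡[mod]-sym (c*t≡b*x (suc μ))))
        (subst (λ k → k ≡ b * x i [mod a ]) (sym c*t[1+μ]+c*Z≡c*t) (c*t≡b*x i)))

    X⇒x : ∀ {y} → InX a b c r y → ∃[ i ] i ≤ μ × y ≡ x i
    X⇒x y∈X = let i , y≡x , least = InX⇒lattice y∈X in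
      i , ≮⇒≥ (λ μ<i → not-least-beyond i μ<i least) , y≡x

    X⇔x : ∀ y → InX a b c r y ⇔ (∃[ i ] i ≤ μ × y ≡ x i)
    X⇔x y = mk⇔ X⇒x λ { (i , i≤μ , refl) → x∈X i i≤μ }

    open GapStructure r u μ x 0<x x≤r x[0]≡r (x[1]+u≡r u<r) 0<u (λ i j sum≤r → proj₂ (x-add-≤ i j sum≤r))
                      x-add-> r<x+x x≢r
    open Enumeration (InX a b c r) X⇒x x∈X

    theorem :
      ((y : ℕ) → InX a b c r y ⇔ (∃[ i ] (i ≤ μ × y ≡ x i)))
      × (InX a b c r (x μ) × u < x μ × (∀ y → InX a b c r y → u < y → x μ ≤ y))
      × (∀ xhat → InX a b c r xhat → (∀ y → InX a b c r y → xhat ≤ y) →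
           ∀ y z → InX a b c r y → InX a b c r z → y < z → (∀ w → InX a b c r w → y < w → z ≤ w) →
           z ≡ y + xhat ⊎ z + x μ ≡ y + xhat + u)
    theorem = X⇔x , (x∈X μ ≤-refl , u<x[μ] , x[μ]-least-above-u)
            , λ x̂ x̂∈X x̂-least y z y∈X z∈X y<z z-next →
                Data.Sum.map₂ shift (consecutive-gaps x̂ x̂∈X x̂-least y z y∈X z∈X y<z z-next)
      where
      shift : ∀ {y z} → z + x (suc μ) ≡ y → z + x μ ≡ y + u
      shift {y} {z} z+x[μ+1]≡y = begin
        z + x μ             ≡⟨ cong (z +_) x[μ+1]+u≡x[μ] ⟨
        z + (x (suc μ) + u) ≡⟨ +-assoc z (x (suc μ)) u ⟨
        z + x (suc μ) + u   ≡⟨ cong (_+ u) z+x[μ+1]≡y ⟩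
        y + u               ∎
        where open ≡-Reasoning

module FloorCondition (a b c d q s′ r u : ℕ) .{{_ : NonZero r}} .{{_ : NonZero d}}
  (a≡q*d+r : a ≡ q * d + r) (d≡[1+s′]*r+u : d ≡ suc s′ * r + u) (c*q<b*r : c * q < b * r) where

  open Lattice a d q (suc s′) r u a≡q*d+r d≡[1+s′]*r+u

  A B : ℕ
  A = b * r ∸ c * q
  B = b * (d ∸ r) + c * (q + 1)

  A+c*q≡b*r : A + c * q ≡ b * r
  A+c*q≡b*r = m∸n+n≡m (<⇒≤ c*q<b*r)

  instance
    A-nonZero : NonZero A
    A-nonZero = >-nonZero (m<n⇒0<n∸m c*q<b*r)

  r≤d : r ≤ d
  r≤d = subst (r ≤_) (sym d≡[1+s′]*r+u) (≤-trans (m≤m+n r (s′ * r)) (m≤m+n (r + s′ * r) u))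

  d∸r≡s′*r+u : d ∸ r ≡ s′ * r + u
  d∸r≡s′*r+u = trans (cong (_∸ r) (trans d≡[1+s′]*r+u (+-assoc r (s′ * r) u))) (m+n∸m≡n r (s′ * r + u))

  G : ℕ → ℕ
  G n = n * s′ + f n

  divℕ[n*[d∸r]]≡G : ∀ n → divℕ (n * (d ∸ r)) r ≡ G n
  divℕ[n*[d∸r]]≡G n = begin
    divℕ (n * (d ∸ r)) r        ≡⟨ cong (λ k → divℕ (n * k) r) d∸r≡s′*r+u ⟩
    divℕ (n * (s′ * r + u)) r   ≡⟨ cong (λ k → divℕ k r) (identity n s′ r u) ⟩
    divℕ (n * s′ * r + u * n) r ≡⟨ divℕ-+-* (n * s′) (u * n) r ⟩
    G n                         ∎
    where
    open ≡-Reasoning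
    identity : ∀ n s′ r u → n * (s′ * r + u) ≡ n * s′ * r + u * n
    identity = solve-∀

  r*B≡A*[d∸r]+c*a : r * B ≡ A * (d ∸ r) + c * a
  r*B≡A*[d∸r]+c*a = linear-combination (identity r b (d ∸ r) c q A a d)
    (cong₂ _+_ (cong₂ _+_ (cong ((d ∸ r) *_) (sym A+c*q≡b*r)) (cong (c *_) (sym a≡q*d+r)))
               (cong (c * q *_) (m∸n+n≡m r≤d)))
    where
    identity : ∀ r b e c q A a d →
      r * (b * e + c * (q + 1)) + (e * (A + c * q) + c * a + c * q * d)
        ≡ A * e + c * a + (e * (b * r) + c * (q * d + r) + c * q * (e + r))
    identity = solve-∀

  G*A≤n*B : ∀ n → G n * A ≤ n * B
  G*A≤n*B n = *-cancelˡ-≤ r (begin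
    r * (G n * A)               ≡⟨ *-x∙yz≈y∙xz r (G n) A ⟩
    G n * (r * A)               ≡⟨ cong (G n *_) (*-comm r A) ⟩
    G n * (A * r)               ≡⟨ *-x∙yz≈y∙xz (G n) A r ⟩
    A * (G n * r)               ≤⟨ *-monoʳ-≤ A G*r≤n*[d∸r] ⟩
    A * (n * (d ∸ r))           ≤⟨ m≤m+n (A * (n * (d ∸ r))) (n * (c * a)) ⟩
    A * (n * (d ∸ r)) + n * (c * a) ≡⟨ identity A n (d ∸ r) c a ⟩
    n * (A * (d ∸ r) + c * a)   ≡⟨ cong (n *_) r*B≡A*[d∸r]+c*a ⟨
    n * (r * B)                 ≡⟨ *-x∙yz≈y∙xz n r B ⟩
    r * (n * B)                 ∎)
    where
    open ≤-Reasoning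
    G*r≤n*[d∸r] : G n * r ≤ n * (d ∸ r)
    G*r≤n*[d∸r] = subst (λ k → k * r ≤ n * (d ∸ r)) (divℕ[n*[d∸r]]≡G n) (divℕ*≤ (n * (d ∸ r)) r)
    identity : ∀ A n e c a → A * (n * e) + n * (c * a) ≡ n * (A * e + c * a)
    identity = solve-∀

  [1+G]*A+c*t≡n*B+b*x : ∀ n → suc (G n) * A + c * t n ≡ n * B + b * x n
  [1+G]*A+c*t≡n*B+b*x n = linear-combination (identity n s′ (f n) A c q b r (x n) u (d ∸ r))
    (cong₂ _+_ (cong₂ _+_ (cong (suc (G n) *_) A+c*q≡b*r) (cong (b *_) (sym (x+u*i≡r*[1+f] n))))
               (cong (λ k → n * (b * k)) (sym d∸r≡s′*r+u)))
    where
    identity : ∀ n s′ f A c q b r x u e →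
      suc (n * s′ + f) * A + c * (n + q * suc (f + suc s′ * n))
        + (suc (n * s′ + f) * (b * r) + b * (x + u * n) + n * (b * e))
      ≡ n * (b * e + c * (q + 1)) + b * x
        + (suc (n * s′ + f) * (A + c * q) + b * (r * suc f) + n * (b * (s′ * r + u)))
    identity = solve-∀

  floor-eq⇔cone : ∀ n → (divℕ (n * B) A ≡ divℕ (n * (d ∸ r)) r) ⇔ c * t n < b * x n
  floor-eq⇔cone n = mk⇔
    (λ eq → to (+-<-exchange ([1+G]*A+c*t≡n*B+b*x n))
              (to (divℕ≡⇔ (G n) (G*A≤n*B n)) (trans eq (divℕ[n*[d∸r]]≡G n))))
    (λ c*t<b*x → trans (from (divℕ≡⇔ (G n) (G*A≤n*B n)) (from (+-<-exchange ([1+G]*A+c*t≡n*B+b*x n)) c*t<b*x))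
                       (sym (divℕ[n*[d∸r]]≡G n)))
    where open Equivalence

  floor-neq⇒beyond : Coprime c b → r < c →
                     ∀ n → divℕ (n * B) A ≢ divℕ (n * (d ∸ r)) r → b * x n < c * t n
  floor-neq⇒beyond coprime r<c n neq =
    ≤∧≢⇒< (≮⇒≥ (λ c*t<b*x → neq (Equivalence.from (floor-eq⇔cone n) c*t<b*x))) b*x≢c*t
    where
    b*x≢c*t : b * x n ≢ c * t n
    b*x≢c*t eq = <⇒≱ (≤-<-trans (x≤r n) r<c)
      (∣⇒≤ {{>-nonZero (0<x n)}} (coprime-divisor coprime (divides (t n) (trans eq (*-comm c (t n))))))

  floor-eqs⇒cone : ∀ μ → (∀ i → i < μ → divℕ (suc i * B) A ≡ divℕ (suc i * (d ∸ r)) r) →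
                   ∀ i → i ≤ μ → c * t i < b * x i
  floor-eqs⇒cone μ _ zero _ = subst₂ (λ k l → c * k < b * l) (sym t[0]≡q) (sym x[0]≡r) c*q<b*r
  floor-eqs⇒cone μ eqs (suc i) i<μ = Equivalence.to (floor-eq⇔cone (suc i)) (eqs i i<μ)

module Parameters (a b c ℓ : ℕ) (a<b : a < b) (b<c : b < c) (ℓ<a : ℓ < a)
                  (ℓ*b≡c : modℕ (ℓ * b) a ≡ modℕ c a) (coprime[a,c] : Coprime a c) where

  d q r u s′ : ℕ
  d = a ∸ ℓ
  q = divℕ a d
  r = a ∸ q * d
  u = modℕ d r
  s′ = pred (divℕ d r)

  instance
    d-nonZero : NonZero d
    d-nonZero = >-nonZero (m<n⇒0<n∸m ℓ<a)
    a-nonZero : NonZero a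
    a-nonZero = >-nonZero (≤-<-trans z≤n ℓ<a)

  a≡q*d+r : a ≡ q * d + r
  a≡q*d+r = sym (m+[n∸m]≡n (divℕ*≤ a d))

  r<d : r < d
  r<d = m<n+o⇒m∸n<o a (q * d) (subst (a <_) (+-comm d (q * d)) (divℕ*<suc a d))

  r<c : r < c
  r<c = <-trans (<-≤-trans r<d (m∸n≤m a ℓ)) (<-trans a<b b<c)

  0<q : 0 < q
  0<q = subst (0 <_) (sym (divℕ≡/ a d)) (m≥n⇒m/n>0 (m∸n≤m a ℓ))

  0<r : c * q < b * r → 0 < r
  0<r c*q<b*r = >-nonZero⁻¹ r {{m*n≢0⇒n≢0 b {{>-nonZero (≤-<-trans z≤n c*q<b*r)}}}}

  a∣c+b*d : a ∣ c + b * d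
  a∣c+b*d with modℕ⇒≡[mod] {ℓ * b} {c} {a} ℓ*b≡c
  ... | k , k′ , ℓ*b+k*a≡c+k′*a = ∣m+n∣m⇒∣n
    (divides (b + k) (linear-combination (identity a b c d ℓ k k′)
      (cong₂ _+_ (sym ℓ*b+k*a≡c+k′*a) (cong (_* b) (m+[n∸m]≡n (<⇒≤ ℓ<a))))))
    (n∣m*n k′)
    where
    identity : ∀ a b c d ℓ k k′ →
      k′ * a + (c + b * d) + (ℓ * b + k * a + a * b) ≡ (b + k) * a + (c + k′ * a + (ℓ + d) * b)
    identity = solve-∀

  coprime[a,d] : Coprime a d
  coprime[a,d] {i} (i∣a , i∣d) = coprime[a,c]
    (i∣a , ∣m+n∣m⇒∣n (subst (i ∣_) (+-comm c (b * d)) (∣-trans i∣a a∣c+b*d)) (∣n⇒∣m*n b i∣d))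

  module _ .{{_ : NonZero r}} where

    u<r : u < r
    u<r = subst (_< r) (sym (modℕ≡% d r)) (m%n<n d r)

    s-nonZero : NonZero (divℕ d r)
    s-nonZero = ≢-nonZero λ s≡0 → <⇒≱ r<d (begin
      d                 ≡⟨ m≡m%n+[m/n]*n d r ⟩
      d % r + d / r * r ≡⟨ cong (λ k → d % r + k * r) (trans (sym (divℕ≡/ d r)) s≡0) ⟩
      d % r + 0         ≡⟨ +-identityʳ (d % r) ⟩
      d % r             ≤⟨ m%n≤n d r ⟩
      r                 ∎)
      where open ≤-Reasoning

    d≡[1+s′]*r+u : d ≡ suc s′ * r + u
    d≡[1+s′]*r+u = begin
      d                 ≡⟨ m≡m%n+[m/n]*n d r ⟩
      d % r + d / r * r ≡⟨ cong₂ (λ ρ k → ρ + k * r) (modℕ≡% d r) (divℕ≡/ d r) ⟨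
      u + divℕ d r * r  ≡⟨ +-comm u (divℕ d r * r) ⟩
      divℕ d r * r + u  ≡⟨ cong (λ k → k * r + u) (suc-pred (divℕ d r) {{s-nonZero}}) ⟨
      suc s′ * r + u    ∎
      where open ≡-Reasoning

    coprime[r,u] : Coprime r u
    coprime[r,u] {i} (i∣r , i∣u) = coprime[a,d] (i∣a , i∣d)
      where
      i∣d : i ∣ d
      i∣d = subst (i ∣_) (sym d≡[1+s′]*r+u) (∣m∣n⇒∣m+n (∣n⇒∣m*n (suc s′) i∣r) i∣u)
      i∣a : i ∣ a
      i∣a = subst (i ∣_) (sym a≡q*d+r) (∣m∣n⇒∣m+n (∣n⇒∣m*n q i∣d) i∣r)

mainTheorem9 : (a b c ℓ μ : ℕ) → 2 ≤ a → a < b → b < c →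
    Coprime a b → Coprime b c → Coprime a c →
    ℓ < a → modℕ (ℓ * b) a ≡ modℕ c a →
    let k = divℕ c b
        q = divℕ a (a ∸ ℓ)
        r = a ∸ q * (a ∸ ℓ)
        u = modℕ (a ∸ ℓ) r
        A = b * r ∸ c * q
        B = b * (a ∸ ℓ ∸ r) + c * (q + 1)
        X = InX a b c r
        x = λ i → r * suc (divℕ (u * i) r) ∸ u * i
    in k < ℓ → c * q < b * r →
       divℕ (suc μ * B) A ≢ divℕ (suc μ * (a ∸ ℓ ∸ r)) r →
       (∀ i → i < μ → divℕ (suc i * B) A ≡ divℕ (suc i * (a ∸ ℓ ∸ r)) r) →
       0 < u → divℕ r u < μ →
       ((y : ℕ) → X y ⇔ (∃[ i ] (i ≤ μ × y ≡ x i)))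
       × (X (x μ) × u < x μ × (∀ y → X y → u < y → x μ ≤ y))
       × (∀ xhat → X xhat → (∀ y → X y → xhat ≤ y) →
            ∀ y z → X y → X z → y < z → (∀ w → X w → y < w → z ≤ w) →
            z ≡ y + xhat ⊎ z + x μ ≡ y + xhat + u)
mainTheorem9 a b c ℓ μ _ a<b b<c coprime[a,b] coprime[b,c] coprime[a,c] ℓ<a ℓ*b≡c _
             c*q<b*r floor-neq floor-eqs 0<u _ =
  Representation.theorem a b c d q (suc s′) r u a≡q*d+r d≡[1+s′]*r+u a∣c+b*d
    coprime[a,b] coprime[a,d] coprime[r,u] a<b b<c 0<q 0<u u<r
    μ (floor-eqs⇒cone μ floor-eqs) (floor-neq⇒beyond (Coprimality.sym coprime[b,c]) r<c (suc μ) floor-neq)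
  where
  open Parameters a b c ℓ a<b b<c ℓ<a ℓ*b≡c coprime[a,c]
  instance
    r-nonZero : NonZero r
    r-nonZero = >-nonZero (0<r c*q<b*r)
  open FloorCondition a b c d q s′ r u a≡q*d+r d≡[1+s′]*r+u c*q<b*r
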